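{- Let $n\geq 2$ and let $G_1,\dots,G_n$ be pairwise disjoint connected graphs, indexed so that $\pi(G_1)\geq\pi(G_2)\geq\dots\geq\pi(G_n)$, with chosen vertices $x_i\in V(G_i)$. Let $B(G_1,\dots,G_n)$ be the bouquet obtained by identifying all the vertices $x_1,\dots,x_n$ into a single vertex $x$. Then \[ \pi(B(G_1,\dots,G_n))\leq \pi(G_1)\pi(G_2)+\sum_{i=3}^{n}\bigl(\pi(G_i)-1\bigr). \] Moreover, this bound is tight for the generalized friendship graph $F_{n,4}$ (the bouquet of $n$ copies of $C_4$).
   Context: Let $G=(V,E)$ be a simple connected graph. A configuration is a function $f:V\to\mathbb{N}\cup\{0\}$, with weight $|f|=\sum_{u\in V}f(u)$. A pebbling step from a vertex $u$ to a neighbor $v$ decreases $f(u)$ by two and increases $f(v)$ by one. A configuration is solvable if for every vertex $v$ there is a (possibly empty) sequence of pebbling steps resulting in at least one pebble on $v$. The pebbling number $\pi(G)$ is the minimum $k$ such that every configuration of weight $k$ is solvable. The generalized friendship graph $F_{n,m}$ consists of $n$ cycles of order $m$ sharing one common vertex and otherwise pairwise disjoint. -}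

module Defs where

open import Data.Nat using (ℕ; zero; suc; _+_; _*_; _∸_; _≤_; _<_; pred)
open import Data.Nat.DivMod using (_%_)
open import Data.Fin using (Fin; zero; suc; toℕ; splitAt; punchIn; _≟_)
open import Data.Product using (Σ; ∃; _×_; _,_)
open import Data.Sum using (_⊎_; inj₁; inj₂)
open import Data.Maybe using (Maybe; just; nothing)
open import Data.Bool using (if_then_else_)
open import Data.Empty using (⊥)
open import Relation.Nullary using (¬_)
open import Relation.Nullary.Decidable using (⌊_⌋)
open import Relation.Binary.PropositionalEquality using (_≡_)
open import Relation.Binary.Construct.Closure.ReflexiveTransitive using (Star)

∑ : (n : ℕ) → (Fin n → ℕ) → ℕ
∑ zero    f = 0
∑ (suc n) f = f zero + ∑ n (λ i → f (suc i))

record Graph : Set₁ where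
  field
    size : ℕ
    Adj  : Fin size → Fin size → Set
open Graph public

Symmetric : Graph → Set
Symmetric G = ∀ u v → Adj G u v → Adj G v u

Loopless : Graph → Set
Loopless G = ∀ u → ¬ Adj G u u

Connected : Graph → Set
Connected G = ∀ u v → Star (Adj G) u v

SimpleConnected : Graph → Set
SimpleConnected G = Symmetric G × Loopless G × Connected G

Config : Graph → Set
Config G = Fin (size G) → ℕ

weight : (G : Graph) → Config G → ℕ
weight G f = ∑ (size G) f

moved : (G : Graph) → Config G → Fin (size G) → Fin (size G) → Config G
moved G f u v w =
  (if ⌊ w ≟ u ⌋ then f w ∸ 2 else f w) + (if ⌊ w ≟ v ⌋ then 1 else 0)

Step : (G : Graph) → Config G → Config G → Set
Step G f g = Σ (Fin (size G)) λ u → Σ (Fin (size G)) λ v →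
  Adj G u v × 2 ≤ f u × (∀ w → g w ≡ moved G f u v w)

Solvable : (G : Graph) → Config G → Set
Solvable G f = ∀ v → Σ (Config G) λ g → Star (Step G) f g × 1 ≤ g v

IsPebblingNumber : Graph → ℕ → Set
IsPebblingNumber G k =
  (∀ (f : Config G) → weight G f ≡ k → Solvable G f) ×
  (∀ j → j < k → Σ (Config G) λ f → weight G f ≡ j × ¬ Solvable G f)

-- Vertices: Fin (suc (∑ n (λ i → pred (size (Gs i))))):
--   zero       = the identified root x,
--   suc y      = a non-root vertex of some G_i (decoded by `decode`).

decode : (n : ℕ) (k : Fin n → ℕ) → Fin (∑ n k) → Σ (Fin n) (λ i → Fin (k i))
decode (suc n) k y with splitAt (k zero) y
... | inj₁ a = zero , a
... | inj₂ b with decode n (λ i → k (suc i)) b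
...   | i , c = suc i , c

-- insert a hole at the root: non-root vertices of G as Fin (pred s)
punchIn′ : ∀ {s} → Fin s → Fin (pred s) → Fin s
punchIn′ {suc s} x w = punchIn x w

module _ (n : ℕ) (Gs : Fin n → Graph) (xs : (i : Fin n) → Fin (size (Gs i))) where

  private
    k : Fin n → ℕ
    k i = pred (size (Gs i))

  bouquetSize : ℕ
  bouquetSize = suc (∑ n k)

  toLocal : (i : Fin n) → Fin bouquetSize → Maybe (Fin (size (Gs i)))
  toLocal i zero = just (xs i)
  toLocal i (suc y) with decode n k y
  ... | j , w with i ≟ j
  ...   | Relation.Nullary.yes Relation.Binary.PropositionalEquality.refl = just (punchIn′ (xs i) w)
  ...   | Relation.Nullary.no _ = nothing

  Bouquet : Graph
  Bouquet = record
    { size = bouquetSize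
    ; Adj  = λ u v → Σ (Fin n) λ i → Σ (Fin (size (Gs i))) λ a → Σ (Fin (size (Gs i))) λ b →
               toLocal i u ≡ just a × toLocal i v ≡ just b × Adj (Gs i) a b
    }

C4 : Graph
C4 = record
  { size = 4
  ; Adj  = λ u v → (toℕ v ≡ (toℕ u + 1) % 4) ⊎ (toℕ u ≡ (toℕ v + 1) % 4)
  }

-- F_{n,4}: bouquet of n copies of C₄ (all cycles vertex-transitive, root 0)
Friendship4 : ℕ → Graph
Friendship4 n = Bouquet n (λ _ → C4) (λ _ → zero)

-- the bound  π₁ π₂ + ∑_{i=3}^{n} (π_i − 1)  for n = m + 2
bound : (m : ℕ) → (Fin (suc (suc m)) → ℕ) → ℕ
bound m p = p zero * p (suc zero) + ∑ m (λ j → p (suc (suc j)) ∸ 1)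

-- Split a configuration on the bouquet into r pebbles on the root and Wᵢ pebbles on
-- the rest of each Gᵢ.  Since πᵢ pebbles in Gᵢ can put a pebble on any vertex, q·πᵢ of them can put
-- q pebbles on the root.  To reach a vertex of Gⱼ, first move qᵢ = ⌊Wᵢ/πᵢ⌋ pebbles from every other
-- branch to the root; Gⱼ then holds Wⱼ + r + Σᵢ≠ⱼ qᵢ pebbles.  Were that less than πⱼ, the estimates
-- Wᵢ ≤ qᵢπᵢ + (πᵢ − 1) and πᵢ ≤ M, the largest πᵢ with i ≠ j, would bound the total weight by
-- (M − 1)(πⱼ − 1) + Σᵢ (πᵢ − 1) ≤ (π₁ − 1)(π₂ − 1) + Σᵢ (πᵢ − 1), one less than the bound.
--
-- Put 15 pebbles on the vertex opposite the root in the second 4-cycle and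
-- 3 on the opposite vertex of each later cycle, 15 + 3(n − 2) pebbles in all.  The potential, with (X)
-- the number of pebbles on X,
--   (root) + 2·(neighbours of the root in cycle 1) + 4·(opposite vertex in cycle 1)
--          + Σ over the other cycles of ⌊(2·(neighbours of the root) + (opposite vertex)) / 4⌋
-- never increases under a pebbling step.  It is 3 here, but at least 4 once the opposite vertex of the
-- first cycle carries a pebble, so π(F_{n,4}) ≥ 16 + 3(n − 2); as π(C₄) ≤ 4 this is at least the bound.

module Submission where

open import Defs
open import Data.Nat using (ℕ; zero; suc; _+_; _*_; _∸_; _⊓_; _≤_; _<_; z≤n; s≤s; pred; NonZero; >-nonZero)
open import Data.Nat.Properties hiding (_≟_)
open import Data.Nat.DivMod using (_/_; _%_; m≡m%n+[m/n]*n; m%n<n; m/n*n≤m; /-monoˡ-≤; +-distrib-/-∣ʳ)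
open import Data.Nat.Divisibility using (∣-refl)
open import Data.Nat.Tactic.RingSolver using (solve-∀)
open import Data.Fin using (Fin; zero; suc; toℕ; punchIn; punchOut; splitAt; _↑ˡ_; _↑ʳ_; _≟_)
open import Data.Fin.Patterns using (0F; 1F; 2F; 3F)
open import Data.Fin.Properties
  using (toℕ-injective; splitAt-↑ˡ; splitAt-↑ʳ; splitAt⁻¹-↑ˡ; splitAt⁻¹-↑ʳ; punchInᵢ≢i; punchIn-punchOut; punchOut-punchIn; punchOut-cong)
open import Data.Vec.Functional using (_∷_)
open import Data.Product using (Σ; _×_; _,_; proj₁; proj₂)
open import Data.Sum as Sum using (_⊎_; inj₁; inj₂; [_,_]′)
open import Data.Maybe using (Maybe; just; nothing; maybe′)
open import Data.Maybe.Properties using (just-injective)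
open import Data.Bool using (if_then_else_)
open import Data.Empty using (⊥-elim)
open import Function using (_∘_; id; _⇔_; mk⇔; case_of_)
open import Relation.Nullary using (¬_; yes; no; Dec)
open import Relation.Nullary.Decidable using (⌊_⌋; isYes≗does; does-⇔)
open import Relation.Binary.PropositionalEquality
open import Relation.Binary.Construct.Closure.ReflexiveTransitive using (Star; ε; _◅_; _◅◅_; gmap)
open import Algebra.Properties.CommutativeMonoid.Sum +-0-commutativeMonoid as MonoidSum using (sum)
open import Algebra.Properties.Semiring.Sum +-*-semiring using (*-distribˡ-sum)
open import Algebra.Properties.CommutativeSemigroup +-commutativeSemigroup
  using (xy∙z≈xz∙y; x∙yz≈yx∙z; xy∙z≈y∙xz; x∙yz≈y∙xz)

-- Finite sums

∑≡sum : ∀ n (f : Fin n → ℕ) → ∑ n f ≡ sum f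
∑≡sum zero    f = refl
∑≡sum (suc n) f = cong (f zero +_) (∑≡sum n (λ i → f (suc i)))

∑-cong : ∀ n {f g : Fin n → ℕ} → f ≗ g → ∑ n f ≡ ∑ n g
∑-cong zero    f≗g = refl
∑-cong (suc n) f≗g = cong₂ _+_ (f≗g zero) (∑-cong n (λ i → f≗g (suc i)))

∑-mono-≤ : ∀ n {f g : Fin n → ℕ} → (∀ i → f i ≤ g i) → ∑ n f ≤ ∑ n g
∑-mono-≤ zero    f≤g = z≤n
∑-mono-≤ (suc n) f≤g = +-mono-≤ (f≤g zero) (∑-mono-≤ n (λ i → f≤g (suc i)))

∑-const : ∀ n c → ∑ n (λ _ → c) ≡ n * c
∑-const zero    c = refl
∑-const (suc n) c = cong (c +_) (∑-const n c)

∑-distrib-+ : ∀ n (f g : Fin n → ℕ) → ∑ n (λ i → f i + g i) ≡ ∑ n f + ∑ n g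
∑-distrib-+ n f g = begin
  ∑ n (λ i → f i + g i)  ≡⟨ ∑≡sum n _ ⟩
  sum (λ i → f i + g i)  ≡⟨ MonoidSum.∑-distrib-+ f g ⟩
  sum f + sum g          ≡⟨ cong₂ _+_ (∑≡sum n f) (∑≡sum n g) ⟨
  ∑ n f + ∑ n g          ∎
  where open ≡-Reasoning

*-distribˡ-∑ : ∀ n c (f : Fin n → ℕ) → c * ∑ n f ≡ ∑ n (λ i → c * f i)
*-distribˡ-∑ n c f = begin
  c * ∑ n f               ≡⟨ cong (c *_) (∑≡sum n f) ⟩
  c * sum f               ≡⟨ *-distribˡ-sum c f ⟩
  sum (λ i → c * f i)     ≡⟨ ∑≡sum n _ ⟨
  ∑ n (λ i → c * f i)     ∎
  where open ≡-Reasoning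

∑-remove : ∀ n (f : Fin (suc n) → ℕ) j → ∑ (suc n) f ≡ f j + ∑ n (λ i → f (punchIn j i))
∑-remove n f j = begin
  ∑ (suc n) f                          ≡⟨ ∑≡sum (suc n) f ⟩
  sum f                                ≡⟨ MonoidSum.sum-remove f ⟩
  f j + sum (λ i → f (punchIn j i))    ≡⟨ cong (f j +_) (∑≡sum n _) ⟨
  f j + ∑ n (λ i → f (punchIn j i))    ∎
  where open ≡-Reasoning

∑-zero : ∀ n {f : Fin n → ℕ} → (∀ i → f i ≡ 0) → ∑ n f ≡ 0
∑-zero n f≡0 = trans (∑-cong n f≡0) (trans (∑-const n 0) (*-zeroʳ n))

∑-single : ∀ n (f : Fin n → ℕ) j → (∀ i → i ≢ j → f i ≡ 0) → ∑ n f ≡ f j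
∑-single (suc n) f j vanish = begin
  ∑ (suc n) f                          ≡⟨ ∑-remove n f j ⟩
  f j + ∑ n (λ i → f (punchIn j i))    ≡⟨ cong (f j +_) (∑-zero n (λ i → vanish _ (punchInᵢ≢i j i))) ⟩
  f j + 0                              ≡⟨ +-identityʳ (f j) ⟩
  f j                                  ∎
  where open ≡-Reasoning

∑-++ : ∀ a b (f : Fin (a + b) → ℕ) → ∑ (a + b) f ≡ ∑ a (λ i → f (i ↑ˡ b)) + ∑ b (λ i → f (a ↑ʳ i))
∑-++ zero    b f = refl
∑-++ (suc a) b f = trans (cong (f zero +_) (∑-++ a b (λ i → f (suc i)))) (sym (+-assoc (f zero) _ _))

∑-below : ∀ n (f : Fin n → ℕ) k → k ≤ ∑ n f → Σ (Fin n → ℕ) λ g → (∀ i → g i ≤ f i) × ∑ n g ≡ k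
∑-below zero    f zero    _     = f , (λ ()) , refl
∑-below (suc n) f k       k≤∑f with ∑-below n (λ i → f (suc i)) (k ∸ f zero) (m≤n+o⇒m∸n≤o k (f zero) k≤∑f)
... | g , g≤f , ∑g≡k∸f₀ =
  (f zero ⊓ k) ∷ g , g₀∷g≤f , trans (cong (f zero ⊓ k +_) ∑g≡k∸f₀) (m⊓n+n∸m≡n (f zero) k)
  where
  g₀∷g≤f : ∀ i → ((f zero ⊓ k) ∷ g) i ≤ f i
  g₀∷g≤f zero    = m⊓n≤m (f zero) k
  g₀∷g≤f (suc i) = g≤f i

-- Pebbling steps and reachability

⌊⌋-⇔ : ∀ {a b} {A : Set a} {B : Set b} → A ⇔ B → (a? : Dec A) (b? : Dec B) → ⌊ a? ⌋ ≡ ⌊ b? ⌋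
⌊⌋-⇔ A⇔B a? b? = trans (isYes≗does a?) (trans (does-⇔ A⇔B a? b?) (sym (isYes≗does b?)))

moved-transport : ∀ {G H} (f : Config G) (g : Config H) {u v w u′ v′ w′} → f w ≡ g w′ →
                  (w ≡ u ⇔ w′ ≡ u′) → (w ≡ v ⇔ w′ ≡ v′) → moved G f u v w ≡ moved H g u′ v′ w′
moved-transport f g {u} {v} {w} {u′} {v′} {w′} fw≡gw′ at-u at-v =
  cong₂ _+_ (cong₂ (λ b x → if b then x ∸ 2 else x) (⌊⌋-⇔ at-u (w ≟ u) (w′ ≟ u′)) fw≡gw′)
            (cong (λ b → if b then 1 else 0) (⌊⌋-⇔ at-v (w ≟ v) (w′ ≟ v′)))

≤-doubled-side : ∀ {k} a b c → k ≤ a + c + b → k ≤ 2 * a + c ⊎ k ≤ 2 * b + c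
≤-doubled-side {k} a b c k≤a+c+b =
  Sum.map (λ b≤a → via a (+-monoʳ-≤ (a + c) b≤a))
          (λ a≤b → via b (+-monoˡ-≤ b (+-monoˡ-≤ c a≤b)))
          (≤-total b a)
  where
  x+c+x≡2x+c : ∀ x c → x + c + x ≡ 2 * x + c
  x+c+x≡2x+c = solve-∀
  via : ∀ x → a + c + b ≤ x + c + x → k ≤ 2 * x + c
  via x a+c+b≤x+c+x = ≤-trans k≤a+c+b (≤-trans a+c+b≤x+c+x (≤-reflexive (x+c+x≡2x+c x c)))

module Pebbling (G : Graph) where

  V : Set
  V = Fin (size G)

  infixl 6 _⊕_
  infix 4 _≤ᶜ_ _↝_

  _≤ᶜ_ : Config G → Config G → Set
  f ≤ᶜ g = ∀ w → f w ≤ g w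

  _⊕_ : Config G → Config G → Config G
  (f ⊕ g) w = f w + g w

  ∑ᶜ : ∀ n → (Fin n → Config G) → Config G
  ∑ᶜ n F w = ∑ n (λ i → F i w)

  δ : V → ℕ → Config G
  δ x c w with w ≟ x
  ... | yes _ = c
  ... | no  _ = 0

  δ-self : ∀ x c → δ x c x ≡ c
  δ-self x c with x ≟ x
  ... | yes _   = refl
  ... | no  x≢x = ⊥-elim (x≢x refl)

  δ-other : ∀ x c {w} → w ≢ x → δ x c w ≡ 0
  δ-other x c {w} w≢x with w ≟ x
  ... | yes w≡x = ⊥-elim (w≢x w≡x)
  ... | no  _   = refl

  δ-≤ : ∀ {x c f} → c ≤ f x → δ x c ≤ᶜ f
  δ-≤ {x} c≤fx w with w ≟ x
  ... | yes refl = c≤fx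
  ... | no  _    = z≤n

  δ-+ : ∀ x a b w → δ x (a + b) w ≡ (δ x a ⊕ δ x b) w
  δ-+ x a b w with w ≟ x
  ... | yes _ = refl
  ... | no  _ = refl

  δ-mono : ∀ x {a b} → a ≤ b → δ x a ≤ᶜ δ x b
  δ-mono x a≤b w with w ≟ x
  ... | yes _ = a≤b
  ... | no  _ = z≤n

  δ⊕δ-≤ : ∀ {x y a b f} → x ≢ y → a ≤ f x → b ≤ f y → δ x a ⊕ δ y b ≤ᶜ f
  δ⊕δ-≤ {x} {y} {a} {b} {f} x≢y a≤fx b≤fy w with w ≟ x | w ≟ y
  ... | yes refl | yes refl = ⊥-elim (x≢y refl)
  ... | yes refl | no  _    = subst (_≤ f x) (sym (+-identityʳ a)) a≤fx
  ... | no  _    | yes refl = b≤fy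
  ... | no  _    | no  _    = z≤n

  δ-∑ : ∀ x n (c : Fin n → ℕ) → ∑ᶜ n (λ k → δ x (c k)) ≗ δ x (∑ n c)
  δ-∑ x zero    c w with w ≟ x
  ... | yes _ = refl
  ... | no  _ = refl
  δ-∑ x (suc n) c w = trans (cong (δ x (c zero) w +_) (δ-∑ x n (λ k → c (suc k)) w)) (sym (δ-+ x (c zero) _ w))

  weight-δ : ∀ x c → weight G (δ x c) ≡ c
  weight-δ x c = trans (∑-single (size G) (δ x c) x (λ _ → δ-other x c)) (δ-self x c)

  weight-⊕ : ∀ f g → weight G (f ⊕ g) ≡ weight G f + weight G g
  weight-⊕ f g = ∑-distrib-+ (size G) f g

  moved-⊕ : ∀ f c {u} v w → 2 ≤ f u → moved G (f ⊕ c) u v w ≡ moved G f u v w + c w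
  moved-⊕ f c {u} v w 2≤fu with w ≟ u
  ... | yes refl = trans (cong (_+ arrival) (+-∸-comm (c u) 2≤fu)) (xy∙z≈xz∙y (f u ∸ 2) (c u) arrival)
    where
    arrival : ℕ
    arrival = if ⌊ u ≟ v ⌋ then 1 else 0
  ... | no  _    = xy∙z≈xz∙y (f w) (c w) (if ⌊ w ≟ v ⌋ then 1 else 0)

  moved-elsewhere : ∀ f {u v w} → w ≢ u → w ≢ v → moved G f u v w ≡ f w
  moved-elsewhere f {u} {v} {w} w≢u w≢v with w ≟ u | w ≟ v
  ... | yes w≡u | _       = ⊥-elim (w≢u w≡u)
  ... | no  _   | yes w≡v = ⊥-elim (w≢v w≡v)
  ... | no  _   | no  _   = +-identityʳ (f w)

  Step-resp : ∀ {f f′ g} → f ≗ f′ → Step G f g → Step G f′ g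
  Step-resp {f} {f′} f≗f′ (u , v , u~v , 2≤fu , g≗) =
    u , v , u~v , subst (2 ≤_) (f≗f′ u) 2≤fu ,
    λ w → trans (g≗ w) (moved-transport {G} {G} f f′ {u} {v} {w} (f≗f′ w) (mk⇔ id id) (mk⇔ id id))

  Step-⊕ : ∀ c {f g} → Step G f g → Step G (f ⊕ c) (g ⊕ c)
  Step-⊕ c {f} (u , v , u~v , 2≤fu , g≗) =
    u , v , u~v , ≤-trans 2≤fu (m≤m+n (f u) (c u)) ,
    λ w → trans (cong (_+ c w) (g≗ w)) (sym (moved-⊕ f c v w 2≤fu))

  _↝_ : Config G → Config G → Set
  f ↝ g = Σ (Config G) λ h → Star (Step G) f h × g ≤ᶜ h

  ↝-reflexive : ∀ {f g} → g ≤ᶜ f → f ↝ g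
  ↝-reflexive {f} g≤f = f , ε , g≤f

  ↝-refl : ∀ f → f ↝ f
  ↝-refl f = ↝-reflexive {f} (λ _ → ≤-refl)

  ↝-resp : ∀ {f f′ g} → f ≗ f′ → f ↝ g → f′ ↝ g
  ↝-resp f≗f′ (_ , ε , g≤f) = _ , ε , λ w → ≤-trans (g≤f w) (≤-reflexive (f≗f′ w))
  ↝-resp f≗f′ (h , s ◅ ss , g≤h) = h , Step-resp f≗f′ s ◅ ss , g≤h

  ↝-weaken : ∀ {f g g′} → g′ ≤ᶜ g → f ↝ g → f ↝ g′
  ↝-weaken g′≤g (h , ss , g≤h) = h , ss , λ w → ≤-trans (g′≤g w) (g≤h w)

  ↝-frame : ∀ c {f g} → f ↝ g → f ⊕ c ↝ g ⊕ c
  ↝-frame c (h , ss , g≤h) = h ⊕ c , gmap (_⊕ c) (Step-⊕ c) ss , λ w → +-monoˡ-≤ (c w) (g≤h w)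

  ↝-mono : ∀ {f f′ g} → f ≤ᶜ f′ → f ↝ g → f′ ↝ g
  ↝-mono {f} {f′} f≤f′ f↝g =
    ↝-resp (λ w → m+[n∸m]≡n (f≤f′ w)) (↝-weaken (λ w → m≤m+n _ _) (↝-frame (λ w → f′ w ∸ f w) f↝g))

  ↝-trans : ∀ {f g h} → f ↝ g → g ↝ h → f ↝ h
  ↝-trans (g′ , ss , g≤g′) g↝h with ↝-mono g≤g′ g↝h
  ... | k , ss′ , h≤k = k , ss ◅◅ ss′ , h≤k

  ↝-⊕ : ∀ {f₁ f₂ g₁ g₂} → f₁ ↝ g₁ → f₂ ↝ g₂ → f₁ ⊕ f₂ ↝ g₁ ⊕ g₂
  ↝-⊕ {f₁} {f₂} {g₁} {g₂} f₁↝g₁ f₂↝g₂ = ↝-trans (↝-frame f₂ f₁↝g₁) g₁⊕f₂↝g₁⊕g₂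
    where
    g₁⊕f₂↝g₁⊕g₂ : g₁ ⊕ f₂ ↝ g₁ ⊕ g₂
    g₁⊕f₂↝g₁⊕g₂ = ↝-resp (λ w → +-comm (f₂ w) (g₁ w))
                   (↝-weaken (λ w → ≤-reflexive (+-comm (g₁ w) (g₂ w))) (↝-frame g₁ f₂↝g₂))

  ↝-∑ : ∀ n {F H : Fin n → Config G} → (∀ i → F i ↝ H i) → ∑ᶜ n F ↝ ∑ᶜ n H
  ↝-∑ zero    F↝H = ↝-reflexive (λ _ → z≤n)
  ↝-∑ (suc n) F↝H = ↝-⊕ (F↝H zero) (↝-∑ n (λ i → F↝H (suc i)))

  step-↝ : ∀ {f u v} → Adj G u v → 2 ≤ f u → f ↝ δ v 1
  step-↝ {f} {u} {v} u~v 2≤fu = moved G f u v , (u , v , u~v , 2≤fu , λ _ → refl) ◅ ε , δ-≤ 1≤target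
    where
    1≤target : 1 ≤ moved G f u v v
    1≤target with v ≟ v
    ... | yes _   = m≤n+m 1 _
    ... | no  v≢v = ⊥-elim (v≢v refl)

  edge-transfer : ∀ {u v} → Adj G u v → ∀ k → δ u (2 * k) ↝ δ v k
  edge-transfer u~v zero    = ↝-reflexive (δ-≤ z≤n)
  edge-transfer {u} {v} u~v (suc k) =
    ↝-resp (λ w → sym (trans (cong (λ c → δ u c w) (*-suc 2 k)) (δ-+ u 2 (2 * k) w)))
      (↝-weaken (λ w → ≤-reflexive (δ-+ v 1 k w))
        (↝-⊕ (step-↝ u~v (≤-reflexive (sym (δ-self u 2)))) (edge-transfer u~v k)))

  solvable⇒↝ : ∀ {f} → Solvable G f → ∀ r → f ↝ δ r 1
  solvable⇒↝ solvable r with solvable r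
  ... | g , ss , 1≤gr = g , ss , δ-≤ 1≤gr

  ↝⇒solvable : ∀ {f} → (∀ r → f ↝ δ r 1) → Solvable G f
  ↝⇒solvable f↝ r with f↝ r
  ... | g , ss , δ≤g = g , ss , subst (_≤ g r) (δ-self r 1) (δ≤g r)

  split : ∀ {k f} → k ≤ weight G f →
          Σ (Config G) λ g → Σ (Config G) λ h → (g ⊕ h ≗ f) × weight G g ≡ k × weight G f ≡ k + weight G h
  split {k} {f} k≤wf with ∑-below (size G) f k k≤wf
  ... | g , g≤f , wg≡k = g , h , g⊕h≗f , wg≡k , wf≡k+wh
    where
    h : Config G
    h w = f w ∸ g w
    g⊕h≗f : g ⊕ h ≗ f
    g⊕h≗f w = m+[n∸m]≡n (g≤f w)
    wf≡k+wh : weight G f ≡ k + weight G h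
    wf≡k+wh = trans (∑-cong (size G) (sym ∘ g⊕h≗f)) (trans (weight-⊕ g h) (cong (_+ weight G h) wg≡k))

  module _ {π} (isπ : IsPebblingNumber G π) where

    enough⇒solvable : ∀ {f} → π ≤ weight G f → Solvable G f
    enough⇒solvable π≤wf with split π≤wf
    ... | g , h , g⊕h≗f , wg≡π , _ =
      ↝⇒solvable (λ r → ↝-mono (λ w → ≤-trans (m≤m+n (g w) (h w)) (≤-reflexive (g⊕h≗f w)))
                                (solvable⇒↝ (proj₁ isπ g wg≡π) r))

    unsolvable⇒< : ∀ {f} → ¬ Solvable G f → weight G f < π
    unsolvable⇒< ¬solvable = ≰⇒> (λ π≤wf → ¬solvable (enough⇒solvable π≤wf))

    all-solvable⇒≤ : ∀ {k} → (∀ f → weight G f ≡ k → Solvable G f) → π ≤ k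
    all-solvable⇒≤ {k} solvable = ≮⇒≥ k≮π
      where
      k≮π : ¬ k < π
      k≮π k<π with proj₂ isπ k k<π
      ... | f , wf≡k , ¬solvable = ¬solvable (solvable f wf≡k)

    gather : ∀ q r {f} → q * π ≤ weight G f → f ↝ δ r q
    gather zero    r _ = ↝-reflexive (δ-≤ z≤n)
    gather (suc q) r {f} [1+q]π≤wf with split (≤-trans (m≤m+n π (q * π)) [1+q]π≤wf)
    ... | g , h , g⊕h≗f , wg≡π , wf≡π+wh =
      ↝-resp g⊕h≗f (↝-weaken (λ w → ≤-reflexive (δ-+ r 1 q w))
        (↝-⊕ (solvable⇒↝ (proj₁ isπ g wg≡π) r) (gather q r qπ≤wh)))
      where
      qπ≤wh : q * π ≤ weight G h
      qπ≤wh = +-cancelˡ-≤ π _ _ (subst (π + q * π ≤_) wf≡π+wh [1+q]π≤wf)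

  zero-stuck : ∀ {f g} → (∀ w → f w ≡ 0) → Star (Step G) f g → ∀ w → g w ≡ 0
  zero-stuck f≡0 ε = f≡0
  zero-stuck f≡0 ((u , _ , _ , 2≤fu , _) ◅ _) with subst (2 ≤_) (f≡0 u) 2≤fu
  ... | ()

  pebblingNumber-positive : ∀ {π} → IsPebblingNumber G π → V → 1 ≤ π
  pebblingNumber-positive isπ x =
    subst (_< _) (∑-zero (size G) (λ _ → refl)) (unsolvable⇒< isπ empty-unsolvable)
    where
    empty-unsolvable : ¬ Solvable G (λ _ → 0)
    empty-unsolvable solvable with solvable x
    ... | g , ss , 1≤gx = 1+n≰n (subst (1 ≤_) (zero-stuck (λ _ → refl) ss x) 1≤gx)

  -- Bring n up to two pebbles by 2 ∸ f n moves out of o, then step to t.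
  two-hop : ∀ {f o n t} → Adj G o n → Adj G n t → o ≢ n → 4 ≤ 2 * f n + f o → f ↝ δ t 1
  two-hop {f} {o} {n} {t} o~n n~t o≢n 4≤2fn+fo =
    ↝-mono (δ⊕δ-≤ (o≢n ∘ sym) ≤-refl 2k≤fo)
      (↝-trans shift (↝-mono 2≤n (step-↝ n~t (≤-reflexive (sym (δ-self n 2))))))
    where
    k : ℕ
    k = 2 ∸ f n
    2k≤fo : 2 * k ≤ f o
    2k≤fo = subst (_≤ f o) (sym (*-distribˡ-∸ 2 2 (f n))) (m≤n+o⇒m∸n≤o 4 (2 * f n) 4≤2fn+fo)
    shift : δ n (f n) ⊕ δ o (2 * k) ↝ δ n (f n) ⊕ δ n k
    shift = ↝-⊕ (↝-refl (δ n (f n))) (edge-transfer o~n k)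
    2≤n : δ n 2 ≤ᶜ δ n (f n) ⊕ δ n k
    2≤n w = subst (δ n 2 w ≤_) (δ-+ n (f n) k w) (δ-mono n (m≤n+m∸n 2 (f n)) w)

  square-reach : ∀ {f t n₁ o n₂} → Adj G n₁ t → Adj G n₂ t → Adj G o n₁ → Adj G o n₂ → o ≢ n₁ → o ≢ n₂ →
                 4 ≤ f t + f n₁ + f o + f n₂ → f ↝ δ t 1
  square-reach {f} {t} {n₁} {o} {n₂} n₁~t n₂~t o~n₁ o~n₂ o≢n₁ o≢n₂ 4≤ with 1 ≤? f t
  ... | yes 1≤ft = ↝-reflexive (δ-≤ 1≤ft)
  ... | no  1≰ft =
    [ two-hop o~n₁ n₁~t o≢n₁ , two-hop o~n₂ n₂~t o≢n₂ ]′ (≤-doubled-side (f n₁) (f n₂) (f o) 4≤sides)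
    where
    4≤sides : 4 ≤ f n₁ + f o + f n₂
    4≤sides = subst (λ z → 4 ≤ z + f n₁ + f o + f n₂) (n<1⇒n≡0 (≰⇒> 1≰ft)) 4≤

-- The 4-cycle

next : Fin 4 → Fin 4
next 0F = 1F
next 1F = 2F
next 2F = 3F
next 3F = 0F

C4-edge : ∀ {a b} → Adj C4 a b → b ≡ next a ⊎ a ≡ next b
C4-edge {a} {b} =
  Sum.map (λ e → toℕ-injective (trans e (toℕ-next a))) (λ e → toℕ-injective (trans e (toℕ-next b)))
  where
  toℕ-next : ∀ a → (toℕ a + 1) % 4 ≡ toℕ (next a)
  toℕ-next 0F = refl
  toℕ-next 1F = refl
  toℕ-next 2F = refl
  toℕ-next 3F = refl

module _ where
  open Pebbling C4

  C4-reach : ∀ f → 4 ≤ weight C4 f → ∀ t → f ↝ δ t 1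
  C4-reach f 4≤wf = reach
    where
    f₀ f₁ f₂ f₃ : ℕ
    f₀ = f 0F
    f₁ = f 1F
    f₂ = f 2F
    f₃ = f 3F
    -- The k-th rotation lists the target k, a neighbour, the opposite vertex and the other neighbour.
    rotate : ∀ a b c d → a + b + c + d ≡ b + c + d + a
    rotate = solve-∀
    unfold-weight : ∀ a b c d → a + (b + (c + (d + 0))) ≡ a + b + c + d
    unfold-weight = solve-∀
    4≤₀ : 4 ≤ f₀ + f₁ + f₂ + f₃
    4≤₀ = subst (4 ≤_) (unfold-weight f₀ f₁ f₂ f₃) 4≤wf
    4≤₁ : 4 ≤ f₁ + f₂ + f₃ + f₀
    4≤₁ = subst (4 ≤_) (rotate f₀ f₁ f₂ f₃) 4≤₀
    4≤₂ : 4 ≤ f₂ + f₃ + f₀ + f₁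
    4≤₂ = subst (4 ≤_) (rotate f₁ f₂ f₃ f₀) 4≤₁
    4≤₃ : 4 ≤ f₃ + f₀ + f₁ + f₂
    4≤₃ = subst (4 ≤_) (rotate f₂ f₃ f₀ f₁) 4≤₂
    reach : ∀ t → f ↝ δ t 1
    reach 0F = square-reach (inj₂ refl) (inj₁ refl) (inj₂ refl) (inj₁ refl) (λ ()) (λ ()) 4≤₀
    reach 1F = square-reach (inj₂ refl) (inj₁ refl) (inj₂ refl) (inj₁ refl) (λ ()) (λ ()) 4≤₁
    reach 2F = square-reach (inj₂ refl) (inj₁ refl) (inj₂ refl) (inj₁ refl) (λ ()) (λ ()) 4≤₂
    reach 3F = square-reach (inj₂ refl) (inj₁ refl) (inj₂ refl) (inj₁ refl) (λ ()) (λ ()) 4≤₃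

  C4-pebblingNumber≤4 : ∀ {c} → IsPebblingNumber C4 c → c ≤ 4
  C4-pebblingNumber≤4 isc = all-solvable⇒≤ isc (λ f wf≡4 → ↝⇒solvable (C4-reach f (≤-reflexive (sym wf≡4))))

-- Arithmetic of the bound

suc[m∸1]≡m : ∀ {m} → 1 ≤ m → suc (m ∸ 1) ≡ m
suc[m∸1]≡m = m+[n∸m]≡n

m≤[m/n]*n+[n∸1] : ∀ m n .{{_ : NonZero n}} → m ≤ m / n * n + (n ∸ 1)
m≤[m/n]*n+[n∸1] m (suc n) = begin
  m                             ≡⟨ m≡m%n+[m/n]*n m (suc n) ⟩
  m % suc n + m / suc n * suc n ≤⟨ +-monoˡ-≤ _ (≤-pred (m%n<n m (suc n))) ⟩
  n + m / suc n * suc n         ≡⟨ +-comm n _ ⟩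
  m / suc n * suc n + n         ∎
  where open ≤-Reasoning

bound-excess : ∀ m (p : Fin (suc (suc m)) → ℕ) → (∀ i → 1 ≤ p i) →
               bound m p ≡ suc ((p zero ∸ 1) * (p (suc zero) ∸ 1) + ∑ (suc (suc m)) (λ i → p i ∸ 1))
bound-excess m p 1≤p = begin
  p zero * p (suc zero) + R     ≡⟨ cong₂ (λ a b → a * b + R) (sym (suc[m∸1]≡m (1≤p zero)))
                                                              (sym (suc[m∸1]≡m (1≤p (suc zero)))) ⟩
  suc x * suc y + R             ≡⟨ expand x y R ⟩
  suc (x * y + (x + (y + R)))   ∎
  where
  open ≡-Reasoning
  x y R : ℕ
  x = p zero ∸ 1
  y = p (suc zero) ∸ 1
  R = ∑ m (λ j → p (suc (suc j)) ∸ 1)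
  expand : ∀ x y R → suc x * suc y + R ≡ suc (x * y + (x + (y + R)))
  expand = solve-∀

module _ {m} (p : Fin (suc (suc m)) → ℕ) (sorted : ∀ i j → i Data.Fin.≤ j → p j ≤ p i) where

  partner : Fin (suc (suc m)) → Fin (suc (suc m))
  partner zero    = suc zero
  partner (suc _) = zero

  partner-max : ∀ j k → p (punchIn j k) ≤ p (partner j)
  partner-max zero    k = sorted (suc zero) (suc k) (s≤s z≤n)
  partner-max (suc _) k = sorted zero _ z≤n

  partner-product : ∀ j → (p (partner j) ∸ 1) * (p j ∸ 1) ≤ (p zero ∸ 1) * (p (suc zero) ∸ 1)
  partner-product zero    = ≤-reflexive (*-comm (p (suc zero) ∸ 1) (p zero ∸ 1))
  partner-product (suc j) = *-monoʳ-≤ (p zero ∸ 1) (∸-monoˡ-≤ 1 (sorted (suc zero) (suc j) (s≤s z≤n)))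

  module _ (1≤p : ∀ i → 1 ≤ p i) (W q : Fin (suc (suc m)) → ℕ) (W≤ : ∀ i → W i ≤ q i * p i + (p i ∸ 1))
           (A : ℕ) (j : Fin (suc (suc m))) where

    private
      x y pⱼ′ M S Y D : ℕ
      x = p zero ∸ 1
      y = p (suc zero) ∸ 1
      pⱼ′ = p j ∸ 1
      M = p (partner j)
      S = W j + A
      Y = ∑ (suc m) (λ k → q (punchIn j k))
      D = ∑ (suc m) (λ k → p (punchIn j k) ∸ 1)

    others-≤ : ∑ (suc m) (λ k → W (punchIn j k)) ≤ M * Y + D
    others-≤ = begin
      ∑ (suc m) (λ k → W (punchIn j k))                             ≤⟨ ∑-mono-≤ (suc m) per-branch ⟩
      ∑ (suc m) (λ k → M * q (punchIn j k) + (p (punchIn j k) ∸ 1)) ≡⟨ ∑-distrib-+ (suc m) ((M *_) ∘ qⱼ) pⱼ∸1 ⟩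
      ∑ (suc m) (λ k → M * q (punchIn j k)) + D                     ≡⟨ cong (_+ D) (*-distribˡ-∑ (suc m) M qⱼ) ⟨
      M * Y + D                                                     ∎
      where
      open ≤-Reasoning
      qⱼ pⱼ∸1 : Fin (suc m) → ℕ
      qⱼ k = q (punchIn j k)
      pⱼ∸1 k = p (punchIn j k) ∸ 1
      per-branch : ∀ k → W (punchIn j k) ≤ M * q (punchIn j k) + (p (punchIn j k) ∸ 1)
      per-branch k = ≤-trans (W≤ (punchIn j k))
        (+-monoˡ-≤ _ (≤-trans (*-monoʳ-≤ (q (punchIn j k)) (partner-max j k)) (≤-reflexive (*-comm _ M))))

    short-⇒-total-≤ : W j + (A + Y) < p j → A + ∑ (suc (suc m)) W ≤ x * y + (pⱼ′ + D)
    short-⇒-total-≤ short = begin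
      A + ∑ (suc (suc m)) W                     ≡⟨ cong (A +_) (∑-remove (suc m) W j) ⟩
      A + (W j + ∑ (suc m) (λ k → W (punchIn j k))) ≡⟨ x∙yz≈yx∙z A (W j) _ ⟩
      S + ∑ (suc m) (λ k → W (punchIn j k))     ≤⟨ +-monoʳ-≤ S others-≤ ⟩
      S + (M * Y + D)                           ≡⟨ +-assoc S (M * Y) D ⟨
      S + M * Y + D                             ≤⟨ +-monoˡ-≤ D (+-monoˡ-≤ (M * Y) S≤MS) ⟩
      M * S + M * Y + D                         ≡⟨ cong (_+ D) (*-distribˡ-+ M S Y) ⟨
      M * (S + Y) + D                           ≤⟨ +-monoˡ-≤ D (*-monoʳ-≤ M S+Y≤pⱼ′) ⟩
      M * pⱼ′ + D                               ≤⟨ +-monoˡ-≤ D Mpⱼ′≤ ⟩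
      pⱼ′ + x * y + D                           ≡⟨ xy∙z≈y∙xz pⱼ′ (x * y) D ⟩
      x * y + (pⱼ′ + D)                         ∎
      where
      open ≤-Reasoning
      S≤MS : S ≤ M * S
      S≤MS = m≤n*m S M {{>-nonZero (1≤p (partner j))}}
      S+Y≤pⱼ′ : S + Y ≤ pⱼ′
      S+Y≤pⱼ′ = subst (_≤ pⱼ′) (sym (+-assoc (W j) A Y))
                  (≤-pred (subst (W j + (A + Y) <_) (sym (suc[m∸1]≡m (1≤p j))) short))
      Mpⱼ′≤ : M * pⱼ′ ≤ pⱼ′ + x * y
      Mpⱼ′≤ = subst (λ z → z * pⱼ′ ≤ pⱼ′ + x * y) (suc[m∸1]≡m (1≤p (partner j)))
                (+-monoʳ-≤ pⱼ′ (partner-product j))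

    bound-suffices : A + ∑ (suc (suc m)) W ≡ bound m p → p j ≤ W j + (A + Y)
    bound-suffices total≡bound =
      ≮⇒≥ λ short → 1+n≰n (subst (_≤ x * y + (pⱼ′ + D)) total≡excess (short-⇒-total-≤ short))
      where
      total≡excess : A + ∑ (suc (suc m)) W ≡ suc (x * y + (pⱼ′ + D))
      total≡excess = trans total≡bound (trans (bound-excess m p 1≤p)
                       (cong (λ z → suc (x * y + z)) (∑-remove (suc m) (λ i → p i ∸ 1) j)))

-- Bouquets

encode : ∀ n (k : Fin n → ℕ) (i : Fin n) → Fin (k i) → Fin (∑ n k)
encode (suc n) k zero    c = c ↑ˡ ∑ n (λ i → k (suc i))
encode (suc n) k (suc i) c = k zero ↑ʳ encode n (λ i → k (suc i)) i c

decode-encode : ∀ n k i c → decode n k (encode n k i c) ≡ (i , c)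
decode-encode (suc n) k zero    c rewrite splitAt-↑ˡ (k zero) c (∑ n (λ i → k (suc i))) = refl
decode-encode (suc n) k (suc i) c
  rewrite splitAt-↑ʳ (k zero) (∑ n (λ i → k (suc i))) (encode n (λ i → k (suc i)) i c)
        | decode-encode n (λ i → k (suc i)) i c = refl

encode-surjective : ∀ n k (y : Fin (∑ n k)) → Σ (Fin n) λ i → Σ (Fin (k i)) λ c → y ≡ encode n k i c
encode-surjective (suc n) k y with splitAt (k zero) y in eq
... | inj₁ c = zero , c , sym (splitAt⁻¹-↑ˡ eq)
... | inj₂ y′ with encode-surjective n (λ i → k (suc i)) y′
...   | i , c , y′≡ = suc i , c , trans (sym (splitAt⁻¹-↑ʳ eq)) (cong (k zero ↑ʳ_) y′≡)

∑-encode : ∀ n k (f : Fin (∑ n k) → ℕ) → ∑ (∑ n k) f ≡ ∑ n (λ i → ∑ (k i) (λ c → f (encode n k i c)))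
∑-encode zero    k f = refl
∑-encode (suc n) k f =
  trans (∑-++ (k zero) _ f)
        (cong (∑ (k zero) (λ c → f (c ↑ˡ _)) +_) (∑-encode n (λ i → k (suc i)) (λ y → f (k zero ↑ʳ y))))

punchOut′ : ∀ {s} {x a : Fin s} → a ≢ x → Fin (pred s)
punchOut′ {suc s} a≢x = punchOut (a≢x ∘ sym)

punchIn′≢ : ∀ {s} (x : Fin s) c → punchIn′ x c ≢ x
punchIn′≢ {suc s} x c = punchInᵢ≢i x c

punchIn′-punchOut′ : ∀ {s} {x a : Fin s} (a≢x : a ≢ x) → punchIn′ x (punchOut′ a≢x) ≡ a
punchIn′-punchOut′ {suc s} a≢x = punchIn-punchOut (a≢x ∘ sym)

punchOut′-punchIn′ : ∀ {s} (x : Fin s) {c} (a≢x : punchIn′ x c ≢ x) → punchOut′ a≢x ≡ c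
punchOut′-punchIn′ {suc s} x a≢x = trans (punchOut-cong x refl) (punchOut-punchIn x)

∑-punchIn′ : ∀ {s} (x : Fin s) (f : Fin s → ℕ) → ∑ s f ≡ f x + ∑ (pred s) (λ c → f (punchIn′ x c))
∑-punchIn′ {suc s} x f = ∑-remove s f x

module BouquetStructure (n : ℕ) (Gs : Fin n → Graph) (xs : (i : Fin n) → Fin (size (Gs i))) where

  B : Graph
  B = Bouquet n Gs xs

  K : Fin n → ℕ
  K i = pred (size (Gs i))

  branch : (i : Fin n) → Fin (K i) → Fin (size B)
  branch i c = suc (encode n K i c)

  toLocal′ : (i : Fin n) → Fin (size B) → Maybe (Fin (size (Gs i)))
  toLocal′ = toLocal n Gs xs

  vertex-view : ∀ w → w ≡ zero ⊎ Σ (Fin n) λ j → Σ (Fin (K j)) λ c → w ≡ branch j c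
  vertex-view zero    = inj₁ refl
  vertex-view (suc y) with encode-surjective n K y
  ... | j , c , y≡ = inj₂ (j , c , cong suc y≡)

  toLocal-own : ∀ i c → toLocal′ i (branch i c) ≡ just (punchIn′ (xs i) c)
  toLocal-own i c rewrite decode-encode n K i c with i ≟ i
  ... | yes refl = refl
  ... | no  i≢i  = ⊥-elim (i≢i refl)

  toLocal-other : ∀ {i j} c → i ≢ j → toLocal′ i (branch j c) ≡ nothing
  toLocal-other {i} {j} c i≢j rewrite decode-encode n K j c with i ≟ j
  ... | yes i≡j = ⊥-elim (i≢j i≡j)
  ... | no  _   = refl

  ι : (i : Fin n) → Fin (size (Gs i)) → Fin (size B)
  ι i a with a ≟ xs i
  ... | yes _   = zero
  ... | no  a≢x = branch i (punchOut′ a≢x)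

  ι-root : ∀ i → ι i (xs i) ≡ zero
  ι-root i with xs i ≟ xs i
  ... | yes _   = refl
  ... | no  x≢x = ⊥-elim (x≢x refl)

  ι-own : ∀ i c → ι i (punchIn′ (xs i) c) ≡ branch i c
  ι-own i c with punchIn′ (xs i) c ≟ xs i
  ... | yes a≡x = ⊥-elim (punchIn′≢ (xs i) c a≡x)
  ... | no  a≢x = cong (branch i) (punchOut′-punchIn′ (xs i) a≢x)

  toLocal-ι : ∀ i a → toLocal′ i (ι i a) ≡ just a
  toLocal-ι i a with a ≟ xs i
  ... | yes refl = refl
  ... | no  a≢x  = trans (toLocal-own i (punchOut′ a≢x)) (cong just (punchIn′-punchOut′ a≢x))

  toLocal⇒ι : ∀ i {w a} → toLocal′ i w ≡ just a → w ≡ ι i a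
  toLocal⇒ι i {w} {a} toLocal≡ with vertex-view w
  ... | inj₁ refl = trans (sym (ι-root i)) (cong (ι i) (just-injective toLocal≡))
  ... | inj₂ (j , c , refl) with i ≟ j
  ...   | yes refl = trans (sym (ι-own i c)) (cong (ι i) (just-injective (trans (sym (toLocal-own i c)) toLocal≡)))
  ...   | no  i≢j with () ← trans (sym (toLocal-other c i≢j)) toLocal≡

  ι-injective : ∀ i {a b} → ι i a ≡ ι i b → a ≡ b
  ι-injective i {a} {b} ιa≡ιb =
    just-injective (trans (sym (toLocal-ι i a)) (trans (cong (toLocal′ i) ιa≡ιb) (toLocal-ι i b)))

  ι-disjoint : ∀ {i j a b} → i ≢ j → ι i a ≡ ι j b → a ≡ xs i
  ι-disjoint {i} {j} {a} {b} i≢j ιa≡ιb with a ≟ xs i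
  ... | yes a≡x = a≡x
  ... | no  a≢x with () ← trans (sym (toLocal-other (punchOut′ a≢x) (i≢j ∘ sym)))
                                (trans (cong (toLocal′ j) ιa≡ιb) (toLocal-ι j b))

  module PB = Pebbling B
  module PG (i : Fin n) = Pebbling (Gs i)

  embed : (i : Fin n) → Config (Gs i) → Config B
  embed i h w = maybe′ h 0 (toLocal′ i w)

  embed-ι : ∀ i h a → embed i h (ι i a) ≡ h a
  embed-ι i h a rewrite toLocal-ι i a = refl

  ≡⇔ι≡ : ∀ i {a b} → a ≡ b ⇔ ι i a ≡ ι i b
  ≡⇔ι≡ i = mk⇔ (cong (ι i)) (ι-injective i)

  ι-image? : ∀ i w → (Σ (Fin (size (Gs i))) λ a → w ≡ ι i a) ⊎ (∀ a → w ≢ ι i a)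
  ι-image? i w with toLocal′ i w in toLocal≡
  ... | just a  = inj₁ (a , toLocal⇒ι i toLocal≡)
  ... | nothing = inj₂ λ { a refl → case trans (sym toLocal≡) (toLocal-ι i a) of λ () }

  embed-outside : ∀ i h {w} → (∀ a → w ≢ ι i a) → embed i h w ≡ 0
  embed-outside i h {w} off with toLocal′ i w in toLocal≡
  ... | just a  = ⊥-elim (off a (toLocal⇒ι i toLocal≡))
  ... | nothing = refl

  lift-step : ∀ i {l l′} → Step (Gs i) l l′ → Step B (embed i l) (embed i l′)
  lift-step i {l} {l′} (u , v , u~v , 2≤lu , l′≗) =
    ι i u , ι i v , (i , u , v , toLocal-ι i u , toLocal-ι i v , u~v) , subst (2 ≤_) (sym (embed-ι i l u)) 2≤lu , pointwise
    where
    pointwise : ∀ w → embed i l′ w ≡ moved B (embed i l) (ι i u) (ι i v) w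
    pointwise w with ι-image? i w
    ... | inj₁ (a , refl) = begin
      embed i l′ (ι i a)                          ≡⟨ embed-ι i l′ a ⟩
      l′ a                                        ≡⟨ l′≗ a ⟩
      moved (Gs i) l u v a                        ≡⟨ moved-transport {Gs i} {B} l (embed i l) (sym (embed-ι i l a))
                                                                         (≡⇔ι≡ i) (≡⇔ι≡ i) ⟩
      moved B (embed i l) (ι i u) (ι i v) (ι i a) ∎
      where open ≡-Reasoning
    ... | inj₂ off = trans (embed-outside i l′ off)
                           (sym (trans (PB.moved-elsewhere (embed i l) (off u) (off v)) (embed-outside i l off)))

  lift-↝ : ∀ i {l l′} → PG._↝_ i l l′ → PB._↝_ (embed i l) (embed i l′)
  lift-↝ i (h , ss , l′≤h) = embed i h , gmap (embed i) (lift-step i) ss , embed-mono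
    where
    embed-mono : ∀ w → embed i _ w ≤ embed i h w
    embed-mono w with toLocal′ i w
    ... | just a  = l′≤h a
    ... | nothing = z≤n

  embed-⊕ : ∀ i f g → embed i (PG._⊕_ i f g) ≗ PB._⊕_ (embed i f) (embed i g)
  embed-⊕ i f g w with toLocal′ i w
  ... | just _  = refl
  ... | nothing = refl

  embed-δ : ∀ i a c → embed i (PG.δ i a c) ≗ PB.δ (ι i a) c
  embed-δ i a c w with ι-image? i w
  ... | inj₂ off = trans (embed-outside i _ off) (sym (PB.δ-other (ι i a) c (off a)))
  ... | inj₁ (b , refl) with b ≟ a
  ...   | yes refl = trans (embed-ι i _ b) (trans (PG.δ-self i b c) (sym (PB.δ-self (ι i b) c)))
  ...   | no  b≢a  =
    trans (embed-ι i _ b) (trans (PG.δ-other i a c b≢a) (sym (PB.δ-other (ι i a) c (b≢a ∘ ι-injective i))))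

  embed-δ-root : ∀ i c → embed i (PG.δ i (xs i) c) ≗ PB.δ zero c
  embed-δ-root i c w = trans (embed-δ i (xs i) c w) (cong (λ r → PB.δ r c w) (ι-root i))

  restrict : (i : Fin n) → Config B → Config (Gs i)
  restrict i F a with a ≟ xs i
  ... | yes _ = 0
  ... | no  _ = F (ι i a)

  restrict-root : ∀ i F → restrict i F (xs i) ≡ 0
  restrict-root i F with xs i ≟ xs i
  ... | yes _   = refl
  ... | no  x≢x = ⊥-elim (x≢x refl)

  restrict-branch : ∀ i F c → restrict i F (punchIn′ (xs i) c) ≡ F (branch i c)
  restrict-branch i F c with punchIn′ (xs i) c ≟ xs i
  ... | yes a≡x = ⊥-elim (punchIn′≢ (xs i) c a≡x)
  ... | no  _   = cong F (ι-own i c)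

  weight-restrict : ∀ i F → weight (Gs i) (restrict i F) ≡ ∑ (K i) (λ c → F (branch i c))
  weight-restrict i F = trans (∑-punchIn′ (xs i) (restrict i F))
    (cong₂ _+_ (restrict-root i F) (∑-cong (K i) (restrict-branch i F)))

  weight-decomposition : ∀ F → weight B F ≡ F zero + ∑ n (λ i → weight (Gs i) (restrict i F))
  weight-decomposition F =
    cong (F zero +_) (trans (∑-encode n K (F ∘ suc)) (sym (∑-cong n (λ i → weight-restrict i F))))

  decomposition : ∀ F → F ≗ PB._⊕_ (PB.δ zero (F zero)) (PB.∑ᶜ n (λ i → embed i (restrict i F)))
  decomposition F w with vertex-view w
  ... | inj₁ refl =
    sym (trans (cong₂ _+_ (PB.δ-self zero (F zero)) (∑-zero n (λ i → restrict-root i F))) (+-identityʳ (F zero)))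
  ... | inj₂ (j , c , refl) =
    sym (cong₂ _+_ (PB.δ-other zero (F zero) {branch j c} λ ()) (trans (∑-single n _ j off-branch) on-branch))
    where
    off-branch : ∀ i → i ≢ j → embed i (restrict i F) (branch j c) ≡ 0
    off-branch i i≢j rewrite toLocal-other c i≢j = refl
    on-branch : embed j (restrict j F) (branch j c) ≡ F (branch j c)
    on-branch rewrite toLocal-own j c = restrict-branch j F c

module UpperBound (n′ : ℕ) (Gs : Fin (suc n′) → Graph) (xs : (i : Fin (suc n′)) → Fin (size (Gs i)))
                  (p : Fin (suc n′) → ℕ) (isπ : ∀ i → IsPebblingNumber (Gs i) (p i)) where

  open BouquetStructure (suc n′) Gs xs
  open PB using (_≤ᶜ_; _↝_; δ; _⊕_; ∑ᶜ)

  1≤p : ∀ i → 1 ≤ p i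
  1≤p i = PG.pebblingNumber-positive i (isπ i) (xs i)

  ι-surjective : ∀ w → Σ (Fin (suc n′)) λ j → Σ (Fin (size (Gs j))) λ b → w ≡ ι j b
  ι-surjective w with vertex-view w
  ... | inj₁ refl           = zero , xs zero , sym (ι-root zero)
  ... | inj₂ (j , c , refl) = j , punchIn′ (xs j) c , sym (ι-own j c)

  module _ (F : Config B) where

    W : Fin (suc n′) → ℕ
    W i = weight (Gs i) (restrict i F)

    q : Fin (suc n′) → ℕ
    q i = _/_ (W i) (p i) {{>-nonZero (1≤p i)}}

    W≤ : ∀ i → W i ≤ q i * p i + (p i ∸ 1)
    W≤ i = m≤[m/n]*n+[n∸1] (W i) (p i) {{>-nonZero (1≤p i)}}

    module _ (j : Fin (suc n′)) where

      gathered : ℕ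
      gathered = ∑ n′ (λ k → q (punchIn j k))

      gather-others : ∑ᶜ n′ (λ k → embed (punchIn j k) (restrict (punchIn j k) F)) ↝ δ zero gathered
      gather-others = PB.↝-weaken at-root (PB.↝-∑ n′ λ k → lift-↝ (punchIn j k) (gather-branch (punchIn j k)))
        where
        gather-branch : ∀ i → PG._↝_ i (restrict i F) (PG.δ i (xs i) (q i))
        gather-branch i = PG.gather i (isπ i) (q i) (xs i) (m/n*n≤m (W i) (p i) {{>-nonZero (1≤p i)}})
        at-root : δ zero gathered ≤ᶜ ∑ᶜ n′ (λ k → embed (punchIn j k) (PG.δ (punchIn j k) (xs (punchIn j k)) (q (punchIn j k))))
        at-root w = ≤-reflexive (sym (trans (∑-cong n′ (λ k → embed-δ-root (punchIn j k) _ w)) (PB.δ-∑ zero n′ _ w)))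

      reach-branch : ∀ b → p j ≤ W j + (F zero + gathered) → F ↝ δ (ι j b) 1
      reach-branch b enough = PB.↝-resp regroup (PB.↝-trans gather (PB.↝-resp assemble deliver))
        where
        R : Config (Gs j)
        R = restrict j F
        X : ℕ
        X = F zero + gathered
        L : Config (Gs j)
        L = PG._⊕_ j R (PG.δ j (xs j) X)
        regroup : δ zero (F zero) ⊕ (embed j R ⊕ ∑ᶜ n′ (λ k → embed (punchIn j k) (restrict (punchIn j k) F))) ≗ F
        regroup w = sym (trans (decomposition F w)
                               (cong (δ zero (F zero) w +_) (∑-remove n′ (λ i → embed i (restrict i F) w) j)))
        gather : δ zero (F zero) ⊕ (embed j R ⊕ ∑ᶜ n′ (λ k → embed (punchIn j k) (restrict (punchIn j k) F)))
                 ↝ δ zero (F zero) ⊕ (embed j R ⊕ δ zero gathered)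
        gather = PB.↝-⊕ (PB.↝-refl (δ zero (F zero))) (PB.↝-⊕ (PB.↝-refl (embed j R)) gather-others)
        assemble : embed j L ≗ δ zero (F zero) ⊕ (embed j R ⊕ δ zero gathered)
        assemble w = begin
          embed j L w                ≡⟨ embed-⊕ j R _ w ⟩
          embed j R w + embed j (PG.δ j (xs j) X) w               ≡⟨ cong (embed j R w +_) (embed-δ-root j X w) ⟩
          embed j R w + δ zero X w                                ≡⟨ cong (embed j R w +_) (PB.δ-+ zero (F zero) gathered w) ⟩
          embed j R w + (δ zero (F zero) w + δ zero gathered w)   ≡⟨ x∙yz≈y∙xz (embed j R w) (δ zero (F zero) w) (δ zero gathered w) ⟩
          δ zero (F zero) w + (embed j R w + δ zero gathered w)   ∎
          where open ≡-Reasoning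
        enough′ : p j ≤ weight (Gs j) L
        enough′ = subst (p j ≤_) (sym (trans (PG.weight-⊕ j R _) (cong (W j +_) (PG.weight-δ j (xs j) X)))) enough
        deliver : embed j L ↝ δ (ι j b) 1
        deliver = PB.↝-weaken (λ w → ≤-reflexive (sym (embed-δ j b 1 w)))
                    (lift-↝ j (PG.solvable⇒↝ j (PG.enough⇒solvable j (isπ j) enough′) b))


bouquet-upper-bound : ∀ m (Gs : Fin (suc (suc m)) → Graph) (xs : (i : Fin (suc (suc m))) → Fin (size (Gs i)))
                     (p : Fin (suc (suc m)) → ℕ) → (∀ i → IsPebblingNumber (Gs i) (p i)) →
                     (∀ i j → i Data.Fin.≤ j → p j ≤ p i) →
                     ∀ b → IsPebblingNumber (Bouquet (suc (suc m)) Gs xs) b → b ≤ bound m p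
bouquet-upper-bound m Gs xs p isπ sorted b isb = PB.all-solvable⇒≤ isb solvable
  where
  open BouquetStructure (suc (suc m)) Gs xs
  open UpperBound (suc m) Gs xs p isπ
  solvable : ∀ F → weight B F ≡ bound m p → Solvable B F
  solvable F wF≡bound = PB.↝⇒solvable reach
    where
    reach : ∀ t → PB._↝_ F (PB.δ t 1)
    reach t with ι-surjective t
    ... | j , a , refl = reach-branch F j a
            (bound-suffices p sorted 1≤p (W F) (q F) (W≤ F) (F zero) j (trans (sym (weight-decomposition F)) wF≡bound))

-- The lower bound for F_{n,4}

-- M d o is the value of a 4-cycle of the bouquet holding d pebbles on the two neighbours of the root
-- and o on the vertex opposite the root; no move inside the cycle may increase (root) + M d o.
record CyclePotential : Set where
  field
    M              : ℕ → ℕ → ℕ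
    root→side      : ∀ d o → M (suc d) o ≤ 2 + M d o
    side→root      : ∀ d o → suc (M d o) ≤ M (2 + d) o
    side→opposite  : ∀ d o → M d (suc o) ≤ M (2 + d) o
    opposite→side  : ∀ d o → M (suc d) o ≤ M d (2 + o)

target-cycle : CyclePotential
target-cycle = record
  { M             = λ d o → 2 * d + 4 * o
  ; root→side     = λ d o → ≤-reflexive (e₁ d o)
  ; side→root     = λ d o → ≤-trans (m≤m+n _ 3) (≤-reflexive (e₂ d o))
  ; side→opposite = λ d o → ≤-reflexive (e₃ d o)
  ; opposite→side = λ d o → ≤-trans (m≤m+n _ 6) (≤-reflexive (e₄ d o))
  }
  where
  e₁ : ∀ d o → 2 * suc d + 4 * o ≡ 2 + (2 * d + 4 * o)
  e₁ = solve-∀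
  e₂ : ∀ d o → suc (2 * d + 4 * o) + 3 ≡ 2 * (2 + d) + 4 * o
  e₂ = solve-∀
  e₃ : ∀ d o → 2 * d + 4 * suc o ≡ 2 * (2 + d) + 4 * o
  e₃ = solve-∀
  e₄ : ∀ d o → 2 * suc d + 4 * o + 6 ≡ 2 * d + 4 * (2 + o)
  e₄ = solve-∀

[m+4]/4≡1+m/4 : ∀ m → (m + 4) / 4 ≡ suc (m / 4)
[m+4]/4≡1+m/4 m = trans (+-distrib-/-∣ʳ m ∣-refl) (+-comm (m / 4) 1)

far-cycle : CyclePotential
far-cycle = record
  { M             = λ d o → (2 * d + o) / 4
  ; root→side     = λ d o → ≤-trans (/-monoˡ-≤ 4 (≤-trans (≤-reflexive (e₁ d o)) (+-monoʳ-≤ (2 * d + o) 2≤4)))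
                                      (≤-trans (≤-reflexive ([m+4]/4≡1+m/4 (2 * d + o))) (n≤1+n _))
  ; side→root     = λ d o → ≤-reflexive (trans (sym ([m+4]/4≡1+m/4 (2 * d + o))) (cong (_/ 4) (e₂ d o)))
  ; side→opposite = λ d o → /-monoˡ-≤ 4 (≤-trans (m≤m+n _ 3) (≤-reflexive (e₃ d o)))
  ; opposite→side = λ d o → ≤-reflexive (cong (_/ 4) (e₄ d o))
  }
  where
  2≤4 : 2 ≤ 4
  2≤4 = s≤s (s≤s z≤n)
  e₁ : ∀ d o → 2 * suc d + o ≡ 2 * d + o + 2
  e₁ = solve-∀
  e₂ : ∀ d o → 2 * d + o + 4 ≡ 2 * (2 + d) + o
  e₂ = solve-∀
  e₃ : ∀ d o → 2 * d + suc o + 3 ≡ 2 * (2 + d) + o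
  e₃ = solve-∀
  e₄ : ∀ d o → 2 * suc d + o ≡ 2 * d + (2 + o)
  e₄ = solve-∀

module LocalPotential (P : CyclePotential) where
  open CyclePotential P

  Φ : Config C4 → ℕ
  Φ l = l 0F + M (l 1F + l 3F) (l 2F)

  root→side′ : ∀ {r} d o → 2 ≤ r → r ∸ 2 + M (suc d) o ≤ r + M d o
  root→side′ {suc (suc r)} d o (s≤s (s≤s _)) =
    ≤-trans (+-monoʳ-≤ r (root→side d o)) (≤-reflexive (x∙yz≈y∙xz r 2 (M d o)))

  side→root′ : ∀ r {s} t o → 2 ≤ s → suc r + M (s ∸ 2 + t) o ≤ r + M (s + t) o
  side→root′ r {suc (suc s)} t o (s≤s (s≤s _)) =
    ≤-trans (≤-reflexive (sym (+-suc r _))) (+-monoʳ-≤ r (side→root (s + t) o))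

  side→opposite′ : ∀ r {s} t o → 2 ≤ s → r + M (s ∸ 2 + t) (suc o) ≤ r + M (s + t) o
  side→opposite′ r {suc (suc s)} t o (s≤s (s≤s _)) = +-monoʳ-≤ r (side→opposite (s + t) o)

  opposite→side′ : ∀ r d {o} → 2 ≤ o → r + M (suc d) (o ∸ 2) ≤ r + M d o
  opposite→side′ r d {suc (suc o)} (s≤s (s≤s _)) = +-monoʳ-≤ r (opposite→side d o)

  -- `moved` leaves the untouched coordinates as `x + 0` and the target as `x + 1`; each clause
  -- normalises these and then applies the move of its kind.
  Φ-step : ∀ l {a b} → Adj C4 a b → 2 ≤ l a → Φ (moved C4 l a b) ≤ Φ l
  Φ-step l {a} a~b 2≤la with C4-edge a~b
  Φ-step l {0F} _ 2≤la | inj₁ refl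
    rewrite +-identityʳ (l 0F ∸ 2) | +-identityʳ (l 2F) | +-identityʳ (l 3F) | +-comm (l 1F) 1
    = root→side′ (l 1F + l 3F) (l 2F) 2≤la
  Φ-step l {1F} _ 2≤la | inj₁ refl
    rewrite +-identityʳ (l 0F) | +-identityʳ (l 1F ∸ 2) | +-identityʳ (l 3F) | +-comm (l 2F) 1
    = side→opposite′ (l 0F) (l 3F) (l 2F) 2≤la
  Φ-step l {2F} _ 2≤la | inj₁ refl
    rewrite +-identityʳ (l 0F) | +-identityʳ (l 1F) | +-identityʳ (l 2F ∸ 2) | +-comm (l 3F) 1
          | +-suc (l 1F) (l 3F)
    = opposite→side′ (l 0F) (l 1F + l 3F) 2≤la
  Φ-step l {3F} _ 2≤la | inj₁ refl
    rewrite +-identityʳ (l 1F) | +-identityʳ (l 3F ∸ 2) | +-identityʳ (l 2F) | +-comm (l 0F) 1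
          | +-comm (l 1F) (l 3F ∸ 2) | +-comm (l 1F) (l 3F)
    = side→root′ (l 0F) (l 1F) (l 2F) 2≤la
  Φ-step l {b = 0F} _ 2≤la | inj₂ refl
    rewrite +-identityʳ (l 1F ∸ 2) | +-identityʳ (l 3F) | +-identityʳ (l 2F) | +-comm (l 0F) 1
    = side→root′ (l 0F) (l 3F) (l 2F) 2≤la
  Φ-step l {b = 1F} _ 2≤la | inj₂ refl
    rewrite +-identityʳ (l 0F) | +-identityʳ (l 3F) | +-identityʳ (l 2F ∸ 2) | +-comm (l 1F) 1
    = opposite→side′ (l 0F) (l 1F + l 3F) 2≤la
  Φ-step l {b = 2F} _ 2≤la | inj₂ refl
    rewrite +-identityʳ (l 0F) | +-identityʳ (l 1F) | +-identityʳ (l 3F ∸ 2) | +-comm (l 2F) 1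
          | +-comm (l 1F) (l 3F ∸ 2) | +-comm (l 1F) (l 3F)
    = side→opposite′ (l 0F) (l 1F) (l 2F) 2≤la
  Φ-step l {b = 3F} _ 2≤la | inj₂ refl
    rewrite +-identityʳ (l 0F ∸ 2) | +-identityʳ (l 1F) | +-identityʳ (l 2F) | +-comm (l 3F) 1
          | +-suc (l 1F) (l 3F)
    = root→side′ (l 1F + l 3F) (l 2F) 2≤la

module FriendshipLowerBound (m : ℕ) where

  n : ℕ
  n = suc (suc m)

  open BouquetStructure n (λ _ → C4) (λ _ → 0F)

  potential : Fin n → CyclePotential
  potential 0F      = target-cycle
  potential (suc _) = far-cycle

  cycle : Fin n → Config B → Config C4
  cycle i g c = g (ι i c)

  cycleValue : Fin n → Config B → ℕ
  cycleValue i g = CyclePotential.M (potential i) (cycle i g 1F + cycle i g 3F) (cycle i g 2F)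

  Ψ : Config B → ℕ
  Ψ g = g zero + ∑ n (λ i → cycleValue i g)

  Ψ-split : ∀ i g → Ψ g ≡ LocalPotential.Φ (potential i) (cycle i g) + ∑ (suc m) (λ k → cycleValue (punchIn i k) g)
  Ψ-split i g = trans (cong (g zero +_) (∑-remove (suc m) (λ i → cycleValue i g) i)) (sym (+-assoc (g zero) _ _))

  Ψ-step : ∀ {g g′} → Step B g g′ → Ψ g′ ≤ Ψ g
  Ψ-step {g} {g′} (u , v , (i , a , b , toLocal-u , toLocal-v , a~b) , 2≤gu , g′≗) = begin
    Ψ g′                                   ≡⟨ Ψ-split i g′ ⟩
    Φ (cycle i g′) + rest g′               ≡⟨ cong₂ _+_ (Φ-cong cycle-step) (∑-cong (suc m) other-cycles-unchanged) ⟩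
    Φ (moved C4 (cycle i g) a b) + rest g  ≤⟨ +-monoˡ-≤ (rest g) (Φ-step (cycle i g) a~b 2≤ga) ⟩
    Φ (cycle i g) + rest g                 ≡⟨ Ψ-split i g ⟨
    Ψ g                                    ∎
    where
    open ≤-Reasoning
    open LocalPotential (potential i)
    rest : Config B → ℕ
    rest h = ∑ (suc m) (λ k → cycleValue (punchIn i k) h)
    u≡ιa : u ≡ ι i a
    u≡ιa = toLocal⇒ι i toLocal-u
    2≤ga : 2 ≤ cycle i g a
    2≤ga = subst (λ w → 2 ≤ g w) u≡ιa 2≤gu
    v≡ιb : v ≡ ι i b
    v≡ιb = toLocal⇒ι i toLocal-v
    cycle-step : cycle i g′ ≗ moved C4 (cycle i g) a b
    cycle-step c = trans (g′≗ (ι i c)) (moved-transport {B} {C4} g (cycle i g) refl (at u≡ιa) (at v≡ιb))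
      where
      at : ∀ {x y} → x ≡ ι i y → ι i c ≡ x ⇔ c ≡ y
      at refl = mk⇔ (ι-injective i) (cong (ι i))
    Φ-cong : ∀ {l l′} → l ≗ l′ → Φ l ≡ Φ l′
    Φ-cong l≗l′ = cong₂ _+_ (l≗l′ 0F) (cong₂ (CyclePotential.M (potential i)) (cong₂ _+_ (l≗l′ 1F) (l≗l′ 3F)) (l≗l′ 2F))
    other-cycles-unchanged : ∀ k → cycleValue (punchIn i k) g′ ≡ cycleValue (punchIn i k) g
    other-cycles-unchanged k = cong₂ (CyclePotential.M (potential (punchIn i k)))
                           (cong₂ _+_ (unchanged {1F} (λ ())) (unchanged {3F} (λ ()))) (unchanged {2F} (λ ()))
      where
      unchanged : ∀ {c} → c ≢ 0F → g′ (ι (punchIn i k) c) ≡ g (ι (punchIn i k) c)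
      unchanged {c} c≢0 = trans (g′≗ _) (PB.moved-elsewhere g (away u≡ιa) (away v≡ιb))
        where
        away : ∀ {x y} → x ≡ ι i y → ι (punchIn i k) c ≢ x
        away refl ιc≡ιy = c≢0 (ι-disjoint (punchInᵢ≢i i k) ιc≡ιy)

  Ψ-steps : ∀ {g g′} → Star (Step B) g g′ → Ψ g′ ≤ Ψ g
  Ψ-steps ε        = ≤-refl
  Ψ-steps (s ◅ ss) = ≤-trans (Ψ-steps ss) (Ψ-step s)

  target : Fin (size B)
  target = ι 0F 2F

  4*target≤Ψ : ∀ g → 4 * g target ≤ Ψ g
  4*target≤Ψ g = ≤-trans (m≤n+m (4 * g target) (2 * (g (ι 0F 1F) + g (ι 0F 3F))))
                   (≤-trans (m≤m+n _ _) (m≤n+m _ (g zero)))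

  witnessPebbles : Fin n → Fin 3 → ℕ
  witnessPebbles 1F            1F = 15
  witnessPebbles (suc (suc _)) 1F = 3
  witnessPebbles _             _  = 0

  witness : Config B
  witness zero    = 0
  witness (suc y) = witnessPebbles (proj₁ (decode n K y)) (proj₂ (decode n K y))

  witness-branch : ∀ i c → witness (branch i c) ≡ witnessPebbles i c
  witness-branch i c rewrite decode-encode n K i c = refl

  weight-witness : weight B witness ≡ 15 + m * 3
  weight-witness = trans (∑-encode n K (λ y → witness (suc y)))
    (trans (∑-cong n (λ i → ∑-cong 3 (witness-branch i))) (cong (15 +_) (∑-const m 3)))

  Ψ-witness : Ψ witness ≡ 3
  Ψ-witness = cong (3 +_) (∑-zero m far-cycles)
    where
    far-cycles : ∀ i → cycleValue (suc (suc i)) witness ≡ 0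
    far-cycles i = cong₂ (λ d o → (2 * d + o) / 4)
                     (cong₂ _+_ (witness-branch (suc (suc i)) 0F) (witness-branch (suc (suc i)) 2F))
                     (witness-branch (suc (suc i)) 1F)

  witness-unsolvable : ¬ Solvable B witness
  witness-unsolvable solvable with solvable target
  ... | g , ss , 1≤g = 4≰3 (begin
    4               ≤⟨ *-monoʳ-≤ 4 1≤g ⟩
    4 * g target    ≤⟨ 4*target≤Ψ g ⟩
    Ψ g             ≤⟨ Ψ-steps ss ⟩
    Ψ witness       ≡⟨ Ψ-witness ⟩
    3               ∎)
    where
    open ≤-Reasoning
    4≰3 : ¬ 4 ≤ 3
    4≰3 (s≤s (s≤s (s≤s ())))

  friendship-lower-bound : ∀ {f} → IsPebblingNumber B f → 15 + m * 3 < f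
  friendship-lower-bound {f} isf = subst (_< f) weight-witness (PB.unsolvable⇒< isf witness-unsolvable)

friendship-pebbling-number : ∀ m c f → IsPebblingNumber C4 c → IsPebblingNumber (Friendship4 (suc (suc m))) f →
                             f ≡ bound m (λ _ → c)
friendship-pebbling-number m c f isc isf = ≤-antisym
  (bouquet-upper-bound m (λ _ → C4) (λ _ → 0F) (λ _ → c) (λ _ → isc) (λ _ _ _ → ≤-refl) f isf)
  (≤-trans bound≤ (FriendshipLowerBound.friendship-lower-bound m isf))
  where
  c≤4 : c ≤ 4
  c≤4 = C4-pebblingNumber≤4 isc
  bound≤ : bound m (λ _ → c) ≤ 4 * 4 + m * 3
  bound≤ = +-mono-≤ (*-mono-≤ c≤4 c≤4)
                    (≤-trans (≤-reflexive (∑-const m (c ∸ 1))) (*-monoʳ-≤ m (∸-monoˡ-≤ 1 c≤4)))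

mainTheorem7 : (∀ (m : ℕ) (Gs : Fin (suc (suc m)) → Graph)
    (xs : (i : Fin (suc (suc m))) → Fin (size (Gs i)))
    (p : Fin (suc (suc m)) → ℕ) →
    (∀ i → SimpleConnected (Gs i)) →
    (∀ i → IsPebblingNumber (Gs i) (p i)) →
    (∀ i j → i Data.Fin.≤ j → p j ≤ p i) →
    ∀ b → IsPebblingNumber (Bouquet (suc (suc m)) Gs xs) b → b ≤ bound m p)
    ×
    (∀ (m c f : ℕ) → IsPebblingNumber C4 c →
    IsPebblingNumber (Friendship4 (suc (suc m))) f → f ≡ bound m (λ _ → c))
mainTheorem7 = (λ m Gs xs p _ → bouquet-upper-bound m Gs xs p) , friendship-pebbling-number
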